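{- Let $A(\vec{x},\vec{y})$ and $B(\vec{y},\vec{z})$ be quantifier-free first-order formulas, where $\vec{y}$ are exactly the variables they share. Run the procedure $\textsc{interpolate}(A,B)$ described in the context, using solver oracles satisfying the contracts given there. If $\textsc{interpolate}(A,B)$ returns $\langle \mathsf{unsat}, I\rangle$, then $A\wedge B$ is unsatisfiable and $I$ is a Craig interpolant for $(A,B)$, i.e. $I$ is a formula over $\vec{y}$ with $A\Rightarrow I$ and $I\Rightarrow\neg B$ valid. If $\textsc{interpolate}(A,B)$ returns $\langle \mathsf{sat}, M\rangle$, then $A\wedge B$ is satisfiable and $M$ is a model of both $A$ and $B$.
   Context: A model is a type-consistent assignment of values to variables; $M\vDash F$ means $F$ evaluates to true under $M$. For partial assignments $M_1,M_2$ agreeing on their common variables, $M_1\cup M_2$ is their union; $M\supseteq M_0$ means $M$ extends $M_0$. Two solver objects are used. A solver $S$ keeps a set of asserted formulas (added by $S.\mathrm{assert}(F)$). The call $S.\mathrm{check}()$ returns $\langle\mathsf{sat},M\rangle$ with $M$ a model of the conjunction of all asserted formulas if one exists, and $\langle\mathsf{unsat},\emptyset\rangle$ otherwise. The call $S.\mathrm{check}(M_0)$, for a partial assignment $M_0$, returns $\langle\mathsf{sat},M,\top\rangle$ with $M\supseteq M_0$ and $M$ a model of the asserted formulas $F$ if such $M$ exists; otherwise it returns $\langle\mathsf{unsat},\emptyset,I\rangle$ where $I$ is a "model interpolant": $F\Rightarrow I$ is valid and $M_0\vDash\neg I$; moreover $I$ is a formula whose free variables are among the variables shared by $F$ and the domain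 of $M_0$ (here: among $\vec{y}$). Procedure $\textsc{interpolate}(A,B)$: assert $A$ to solver $S_A$ and $B$ to solver $S_B$; set $I:=\top$. Loop forever: let $\langle r_B,M_B\rangle:=S_B.\mathrm{check}()$; if $r_B=\mathsf{unsat}$ return $\langle\mathsf{unsat},I\rangle$. Otherwise let $\langle r_A,M_A,I_A\rangle:=S_A.\mathrm{check}(M_B)$; if $r_A=\mathsf{sat}$ return $\langle\mathsf{sat},M_A\cup M_B\rangle$. Otherwise set $I:=I\wedge I_A$, call $S_B.\mathrm{assert}(I_A)$, and repeat. -}

module Defs where

open import Data.Empty using (⊥)
open import Data.Unit using (⊤)
open import Data.Maybe using (Maybe; just; nothing)
open import Data.Product using (Σ; ∃; _×_; _,_)
open import Data.Sum using (_⊎_)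
open import Data.List using (List; []; _∷_; _++_)
open import Data.List.Membership.Propositional using (_∈_)
open import Data.List.Relation.Unary.All using (All)
open import Relation.Nullary using (¬_)
open import Relation.Binary.PropositionalEquality using (_≡_)

-- A many-sorted first-order language together with its intended
-- interpretation (the background theory/structure the solvers work in).
-- Val v is the domain of the sort of variable v (so assignments are
-- type-consistent by construction); domains are non-empty.
record Language : Set₁ where
  field
    Var       : Set
    Val       : Var → Set
    inhabited : (v : Var) → Val v
    Atom      : Set
    atomVars  : Atom → List Var
    ⟦_⟧       : Atom → ((v : Var) → Val v) → Set
    local     : (a : Atom) (T T' : (v : Var) → Val v) →
                ((v : Var) → v ∈ atomVars a → T v ≡ T' v) →
                ⟦ a ⟧ T → ⟦ a ⟧ T'

module Semantics (L : Language) where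
  open Language L public

  data Formula : Set where
    atom : Atom → Formula
    tt   : Formula
    ff   : Formula
    neg  : Formula → Formula
    _∧ᶠ_ : Formula → Formula → Formula
    _∨ᶠ_ : Formula → Formula → Formula

  fv : Formula → List Var
  fv (atom a) = atomVars a
  fv tt = []
  fv ff = []
  fv (neg F) = fv F
  fv (F ∧ᶠ G) = fv F ++ fv G
  fv (F ∨ᶠ G) = fv F ++ fv G

  Total : Set
  Total = (v : Var) → Val v

  _⊨ᵗ_ : Total → Formula → Set
  T ⊨ᵗ atom a = ⟦ a ⟧ T
  T ⊨ᵗ tt = ⊤
  T ⊨ᵗ ff = ⊥
  T ⊨ᵗ neg F = ¬ (T ⊨ᵗ F)
  T ⊨ᵗ (F ∧ᶠ G) = (T ⊨ᵗ F) × (T ⊨ᵗ G)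
  T ⊨ᵗ (F ∨ᶠ G) = (T ⊨ᵗ F) ⊎ (T ⊨ᵗ G)

  -- partial (type-consistent) assignments = models
  Asg : Set
  Asg = (v : Var) → Maybe (Val v)

  inDom : Asg → Var → Set
  inDom M v = Σ (Val v) λ x → M v ≡ just x

  _⊇_ : Asg → Asg → Set
  M ⊇ M₀ = (v : Var) (x : Val v) → M₀ v ≡ just x → M v ≡ just x

  _≼_ : Asg → Total → Set
  M ≼ T = (v : Var) (x : Val v) → M v ≡ just x → T v ≡ x

  -- M ⊨ F : M assigns all free variables of F and F evaluates to true
  -- (i.e. true under every total extension; by locality, any one).
  _⊨_ : Asg → Formula → Set
  M ⊨ F = ((v : Var) → v ∈ fv F → inDom M v) × ((T : Total) → M ≼ T → T ⊨ᵗ F)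

  -- union of two partial assignments (used when they agree on common vars)
  _∪_ : Asg → Asg → Asg
  (M₁ ∪ M₂) v with M₁ v
  ... | just x  = just x
  ... | nothing = M₂ v

  ValidImp : Formula → Formula → Set
  ValidImp F G = (T : Total) → T ⊨ᵗ F → T ⊨ᵗ G

  fvs : List Formula → List Var
  fvs [] = []
  fvs (F ∷ Fs) = fv F ++ fvs Fs

  -- a model returned by S.check() assigns only variables of the
  -- asserted formulas
  DomWithin : Asg → List Formula → Set
  DomWithin M Fs = (v : Var) → inDom M v → v ∈ fvs Fs

  Satisfiable : List Formula → Set
  Satisfiable Fs = ∃ λ (T : Total) → All (T ⊨ᵗ_) Fs

  data Result : Set where
    satR   : Asg → Result
    unsatR : Formula → Result

  -- Loop A B Is I r : starting a loop iteration in the state where S_A holds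
  -- {A}, S_B holds B ∷ Is (in assertion order), and the accumulated
  -- interpolant is I, the procedure can return r, given that every oracle
  -- answer obeys its contract.  All oracle behaviours are covered
  -- (the oracles may be arbitrary, even history-dependent/nondeterministic).
  data Loop (A B : Formula) : List Formula → Formula → Result → Set where
    -- S_B.check() = ⟨unsat, ∅⟩ ; contract: no model of the assertions
    stopUnsat : ∀ {Is I} →
      ¬ Satisfiable (B ∷ Is) →
      Loop A B Is I (unsatR I)
    -- S_B.check() = ⟨sat, M_B⟩, S_A.check(M_B) = ⟨sat, M_A, ⊤⟩
    stopSat : ∀ {Is I} (MB MA : Asg) →
      All (MB ⊨_) (B ∷ Is) → DomWithin MB (B ∷ Is) →
      MA ⊇ MB → MA ⊨ A →
      Loop A B Is I (satR (MA ∪ MB))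
    -- S_B.check() = ⟨sat, M_B⟩, S_A.check(M_B) = ⟨unsat, ∅, I_A⟩
    step : ∀ {Is I r} (MB : Asg) (IA : Formula) →
      All (MB ⊨_) (B ∷ Is) → DomWithin MB (B ∷ Is) →
      ValidImp A IA →
      MB ⊨ neg IA →
      ((v : Var) → v ∈ fv IA → v ∈ fv A × inDom MB v) →
      Loop A B (Is ++ (IA ∷ [])) (I ∧ᶠ IA) r →
      Loop A B Is I r

  Interpolate : Formula → Formula → Result → Set
  Interpolate A B r = Loop A B [] tt r

-- Each S_B.assert(I_A) preserves an invariant of the accumulated I: A ⇒ I,
-- I implies every formula asserted to S_B besides B, and all of these
-- mention only variables shared by A and B (I_A lies in the variables of A
-- assigned by M_B, and M_B assigns only variables of formulas in S_B).
-- When S_B turns unsat, B ∧ I is unsatisfiable, i.e. I ⇒ ¬B.  In the sat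
-- case M_A ∪ M_B extends M_A, and through M_A ⊇ M_B also M_B.
module Submission where

open import Defs
open import Data.List using (List; []; _∷_; _++_; [_])
open import Data.List.Properties using (++-assoc; ++-identityʳ)
open import Data.List.Membership.Propositional using (_∈_)
open import Data.List.Membership.Propositional.Properties using (∈-++⁻)
open import Data.List.Relation.Binary.Subset.Propositional using (_⊆_)
open import Data.List.Relation.Unary.All as All using (All; []; _∷_)
open import Data.List.Relation.Unary.All.Properties using (++⁺)
open import Data.Maybe using (just; nothing)
open import Data.Product using (_×_; _,_; proj₁; proj₂)
open import Data.Sum using ([_,_]′)
open import Data.Unit using (tt)
open import Function using (_∘_; id)
open import Relation.Nullary using (¬_)
open import Relation.Binary.PropositionalEquality using (_≡_; refl; sym; trans; cong)

++-⊆ : ∀ {a} {A : Set a} (xs : List A) {ys zs : List A} →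
       xs ⊆ zs → ys ⊆ zs → xs ++ ys ⊆ zs
++-⊆ xs xs⊆zs ys⊆zs p = [ xs⊆zs , ys⊆zs ]′ (∈-++⁻ xs p)

module _ (L : Language) where
  open Semantics L

  fvs-++ : (Fs Gs : List Formula) → fvs (Fs ++ Gs) ≡ fvs Fs ++ fvs Gs
  fvs-++ []       Gs = refl
  fvs-++ (F ∷ Fs) Gs =
    trans (cong (fv F ++_) (fvs-++ Fs Gs)) (sym (++-assoc (fv F) (fvs Fs) (fvs Gs)))

  fvs-∷ʳ⁻ : (Fs : List Formula) (F : Formula) → fvs (Fs ++ [ F ]) ⊆ fvs Fs ++ fv F
  fvs-∷ʳ⁻ Fs F p
    rewrite fvs-++ Fs [ F ] | ++-identityʳ (fv F) = p

  ⊇-trans : ∀ {M₁ M₂ M₃} → M₁ ⊇ M₂ → M₂ ⊇ M₃ → M₁ ⊇ M₃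
  ⊇-trans e₁₂ e₂₃ v x q = e₁₂ v x (e₂₃ v x q)

  ∪-⊇ˡ : ∀ M₁ M₂ → (M₁ ∪ M₂) ⊇ M₁
  ∪-⊇ˡ M₁ M₂ v x q with M₁ v
  ∪-⊇ˡ M₁ M₂ v x refl | just .x = refl

  ⊨-⊇ : ∀ {M M₀ F} → M ⊇ M₀ → M₀ ⊨ F → M ⊨ F
  ⊨-⊇ e (assigned , true) =
      (λ v p → let (x , q) = assigned v p in x , e v x q)
    , (λ T M≼T → true T (λ v x q → M≼T v x (e v x q)))

  complete : Asg → Total
  complete M v with M v
  ... | just x  = x
  ... | nothing = inhabited v

  ≼-complete : ∀ M → M ≼ complete M
  ≼-complete M v x q with M v
  ≼-complete M v x refl | just .x = refl

  ⊨⇒⊨ᵗ-complete : ∀ {M F} → M ⊨ F → complete M ⊨ᵗ F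
  ⊨⇒⊨ᵗ-complete {M} (_ , true) = true (complete M) (≼-complete M)

  all-⊨⇒satisfiable : ∀ {M Fs} → All (M ⊨_) Fs → Satisfiable Fs
  all-⊨⇒satisfiable {M} M⊨Fs = complete M , All.map (λ {F} → ⊨⇒⊨ᵗ-complete {F = F}) M⊨Fs

  IsInterpolant : Formula → Formula → Formula → Set
  IsInterpolant A B I =
      ((v : Var) → v ∈ fv I → v ∈ fv A × v ∈ fv B)
    × ValidImp A I
    × ValidImp I (neg B)

  record LoopInvariant (A B : Formula) (Is : List Formula) (I : Formula) : Set where
    field
      A⇒I         : ValidImp A I
      I⇒Is        : (T : Total) → T ⊨ᵗ I → All (T ⊨ᵗ_) Is
      fv-I⊆fv-A   : fv I ⊆ fv A
      fv-I⊆fv-B   : fv I ⊆ fv B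
      fvs-Is⊆fv-B : fvs Is ⊆ fv B

  module _ {A B : Formula} where

    invariant-init : LoopInvariant A B [] tt
    invariant-init = record
      { A⇒I = λ _ _ → tt ; I⇒Is = λ _ _ → [] ; fv-I⊆fv-A = λ ()
      ; fv-I⊆fv-B = λ () ; fvs-Is⊆fv-B = λ () }

    invariant-step : ∀ {Is I} (MB : Asg) (IA : Formula) →
      DomWithin MB (B ∷ Is) → ValidImp A IA →
      ((v : Var) → v ∈ fv IA → v ∈ fv A × inDom MB v) →
      LoopInvariant A B Is I → LoopInvariant A B (Is ++ [ IA ]) (I ∧ᶠ IA)
    invariant-step {Is} {I} MB IA dom A⇒IA fv-IA inv = record
      { A⇒I         = λ T t → A⇒I T t , A⇒IA T t
      ; I⇒Is        = λ T (tI , tIA) → ++⁺ (I⇒Is T tI) (tIA ∷ [])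
      ; fv-I⊆fv-A   = ++-⊆ (fv I) fv-I⊆fv-A fv-IA⊆fv-A
      ; fv-I⊆fv-B   = ++-⊆ (fv I) fv-I⊆fv-B fv-IA⊆fv-B
      ; fvs-Is⊆fv-B = ++-⊆ (fvs Is) fvs-Is⊆fv-B fv-IA⊆fv-B ∘ fvs-∷ʳ⁻ Is IA
      }
      where
        open LoopInvariant inv

        fv-IA⊆fv-A : fv IA ⊆ fv A
        fv-IA⊆fv-A {v} p = proj₁ (fv-IA v p)

        fv-IA⊆fv-B : fv IA ⊆ fv B
        fv-IA⊆fv-B {v} p = ++-⊆ (fv B) id fvs-Is⊆fv-B (dom v (proj₂ (fv-IA v p)))

    invariant⇒interpolant : ∀ {Is I} → ¬ Satisfiable (B ∷ Is) → LoopInvariant A B Is I →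
      ¬ Satisfiable (A ∷ B ∷ []) × IsInterpolant A B I
    invariant⇒interpolant {I = I} B∷Is-unsat inv =
        (λ { (T , tA ∷ tB ∷ []) → I⇒¬B T (A⇒I T tA) tB })
      , (λ v p → fv-I⊆fv-A p , fv-I⊆fv-B p)
      , A⇒I
      , I⇒¬B
      where
        open LoopInvariant inv
        I⇒¬B : ValidImp I (neg B)
        I⇒¬B T tI tB = B∷Is-unsat (T , tB ∷ I⇒Is T tI)

    -- Correctness does not use M_B ⊨ ¬ I_A; that part of the contract only
    -- guarantees progress.
    loop-unsat : ∀ {Is I J} → Loop A B Is I (unsatR J) → LoopInvariant A B Is I →
      ¬ Satisfiable (A ∷ B ∷ []) × IsInterpolant A B J
    loop-unsat (stopUnsat B∷Is-unsat) inv = invariant⇒interpolant B∷Is-unsat inv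
    loop-unsat (step MB IA _ dom A⇒IA _ fv-IA run) inv =
      loop-unsat run (invariant-step MB IA dom A⇒IA fv-IA inv)

    loop-sat : ∀ {Is I M} → Loop A B Is I (satR M) →
      Satisfiable (A ∷ B ∷ []) × M ⊨ A × M ⊨ B
    loop-sat (step _ _ _ _ _ _ _ run) = loop-sat run
    loop-sat (stopSat MB MA (MB⊨B ∷ _) _ MA⊇MB MA⊨A) =
      all-⊨⇒satisfiable (M⊨A ∷ M⊨B ∷ []) , M⊨A , M⊨B
      where
        M⊨A : (MA ∪ MB) ⊨ A
        M⊨A = ⊨-⊇ {F = A} (∪-⊇ˡ MA MB) MA⊨A
        M⊨B : (MA ∪ MB) ⊨ B
        M⊨B = ⊨-⊇ {F = B} (⊇-trans (∪-⊇ˡ MA MB) MA⊇MB) MB⊨B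

lemma1 : (L : Language) → let open Semantics L in
    (A B : Formula) →
      ((I : Formula) → Interpolate A B (unsatR I) →
          ¬ Satisfiable (A ∷ B ∷ [])
        × ((v : Var) → v ∈ fv I → v ∈ fv A × v ∈ fv B)
        × ValidImp A I
        × ValidImp I (neg B))
    × ((M : Asg) → Interpolate A B (satR M) →
          Satisfiable (A ∷ B ∷ []) × M ⊨ A × M ⊨ B)
lemma1 L A B =
    (λ I run → loop-unsat L run (invariant-init L))
  , (λ M run → loop-sat L run)
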